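{- Let $\lambda\in\mathbb{R}$. For every integer $n\ge 0$, \[ \mathrm{Bel}_{n+1,\lambda}= \sum_{m=0}^{n}\binom{n}{m}\mathrm{Bel}_{m,\lambda}\,(1)_{n-m+1,\lambda}. \]
   Context: For $\lambda\in\mathbb{R}$, $(x)_{0,\lambda}=1$ and $(x)_{n,\lambda}=x(x-\lambda)\cdots(x-(n-1)\lambda)$ for $n\ge1$. The degenerate exponential is $e_\lambda(t)=\sum_{k\ge0}(1)_{k,\lambda}t^k/k!$ (equal to $(1+\lambda t)^{1/\lambda}$ for $\lambda\ne0$, $e^t$ for $\lambda=0$). The degenerate Bell polynomials are defined by $e^{x(e_{\lambda}(t)-1)}=\sum_{n=0}^{\infty}\mathrm{Bel}_{n,\lambda}(x)\frac{t^{n}}{n!}$, and the degenerate Bell numbers are $\mathrm{Bel}_{n,\lambda}=\mathrm{Bel}_{n,\lambda}(1)$. -}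

module Defs where

open import Level using (Level)
open import Algebra.Bundles using (CommutativeRing)
open import Data.Nat using (ℕ; zero; suc; _∸_)
open import Data.Nat.Combinatorics using (_C_)

-- Everything is developed over an arbitrary commutative ring R
-- (the paper's setting is R = ℝ, which stdlib lacks).
module Degenerate {c ℓ : Level} (R : CommutativeRing c ℓ) where
  open CommutativeRing R

  fromℕ : ℕ → Carrier
  fromℕ zero    = 0#
  fromℕ (suc n) = 1# + fromℕ n

  sumTo : ℕ → (ℕ → Carrier) → Carrier
  sumTo zero    f = f 0
  sumTo (suc n) f = sumTo n f + f (suc n)

  fallingλ : Carrier → Carrier → ℕ → Carrier
  fallingλ λ' x zero    = 1#
  fallingλ λ' x (suc n) = fallingλ λ' x n * (x - fromℕ n * λ')

  -- Formal power series in t, stored by EGF coefficients: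
  -- a : ℕ → R represents  Σ_n a n · t^n / n!
  Series : Set c
  Series = ℕ → Carrier

  -- product of EGF series = binomial convolution of coefficients
  _⋆_ : Series → Series → Series
  (a ⋆ b) n = sumTo n (λ m → fromℕ (n C m) * (a m * b (n ∸ m)))

  pow : Series → ℕ → Series
  pow a zero    zero    = 1#
  pow a zero    (suc n) = 0#
  pow a (suc k)         = a ⋆ pow a k

  -- e^{F(t)} = Σ_k F(t)^k / k!   for F with zero constant term,
  -- given inv k = (k!)⁻¹ in R.  The n-th EGF coefficient only involves
  -- k ≤ n since F^k = O(t^k).
  expS : (ℕ → Carrier) → Series → Series
  expS inv F n = sumTo n (λ k → inv k * pow F k n)

  -- EGF coefficients of e_λ(t) = Σ_k (1)_{k,λ} t^k / k!
  eλ : Carrier → Series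
  eλ λ' k = fallingλ λ' 1# k

  -- EGF coefficients of x (e_λ(t) - 1)
  xeλm1 : Carrier → Carrier → Series
  xeλm1 λ' x zero    = 0#
  xeλm1 λ' x (suc k) = x * eλ λ' (suc k)

  BelPoly : (ℕ → Carrier) → Carrier → Carrier → ℕ → Carrier
  BelPoly inv λ' x n = expS inv (xeλm1 λ' x) n

  Bel : (ℕ → Carrier) → Carrier → ℕ → Carrier
  Bel inv λ' n = BelPoly inv λ' 1# n

-- The degenerate Bell numbers are the coefficients of B = e^F with F = e_λ(t) − 1, so
-- the recurrence is the coefficient form of B′ = B · F′ together with F′ = e_λ′ and
-- e_λ′(t) = Σ_k (1)_{k+1,λ} t^k / k!.  On exponential generating functions the
-- derivative is the shift of coefficients and the product is binomial convolution;
-- from the Leibniz rule for that convolution one gets (F^{k+1})′ = (k+1) F^k F′,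
-- and the factor k+1 cancels 1/(k+1)! against 1/k! in e^F = Σ_k F^k / k!.
module Submission where

open import Defs
open import Algebra.Bundles using (CommutativeRing)
open import Data.Nat using (ℕ; zero; suc; _∸_; _!; _≤_; _<_; _≤′_; ≤′-refl; ≤′-step; z≤n; s≤s)
open import Data.Nat.Combinatorics using (_C_; nCk+nC[k+1]≡[n+1]C[k+1]; k>n⇒nCk≡0)
open import Data.Nat.Properties
  using (≤-refl; ≤-trans; m≤n⇒m≤1+n; n≤1+n; ≤⇒≤′; ≤′⇒≤; m∸n≤m; +-∸-assoc)
import Data.Nat as ℕ
open import Relation.Binary.PropositionalEquality as ≡ using (_≡_; cong; cong₂)
import Algebra.Properties.CommutativeSemigroup as CommutativeSemigroupProperties
import Algebra.Properties.Semiring.Mult as SemiringMult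

module SeriesAlgebra {c ℓ} (R : CommutativeRing c ℓ) where
  open CommutativeRing R hiding (zero)
  open Degenerate R
  open SemiringMult semiring using (_×_; ×-homo-+; ×1-homo-*)
  module +-CS = CommutativeSemigroupProperties +-commutativeSemigroup
  module *-CS = CommutativeSemigroupProperties *-commutativeSemigroup
  open import Relation.Binary.Reasoning.Setoid setoid

  sumTo-cong : ∀ n {f g : ℕ → Carrier} → (∀ i → i ≤ n → f i ≈ g i) → sumTo n f ≈ sumTo n g
  sumTo-cong zero    f≈g = f≈g 0 z≤n
  sumTo-cong (suc n) f≈g =
    +-cong (sumTo-cong n (λ i i≤n → f≈g i (m≤n⇒m≤1+n i≤n))) (f≈g (suc n) ≤-refl)

  sumTo-+ : ∀ n (f g : ℕ → Carrier) → sumTo n (λ i → f i + g i) ≈ sumTo n f + sumTo n g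
  sumTo-+ zero    f g = refl
  sumTo-+ (suc n) f g = trans (+-cong (sumTo-+ n f g) refl) (+-CS.interchange _ _ _ _)

  *-distribˡ-sumTo : ∀ n x (f : ℕ → Carrier) → x * sumTo n f ≈ sumTo n (λ i → x * f i)
  *-distribˡ-sumTo zero    x f = refl
  *-distribˡ-sumTo (suc n) x f = trans (distribˡ x _ _) (+-cong (*-distribˡ-sumTo n x f) refl)

  *-distribʳ-sumTo : ∀ n x (f : ℕ → Carrier) → sumTo n f * x ≈ sumTo n (λ i → f i * x)
  *-distribʳ-sumTo n x f =
    trans (*-comm _ _) (trans (*-distribˡ-sumTo n x f) (sumTo-cong n (λ i _ → *-comm _ _)))

  sumTo-zero : ∀ n (f : ℕ → Carrier) → (∀ i → i ≤ n → f i ≈ 0#) → sumTo n f ≈ 0#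
  sumTo-zero n f f≈0 = trans (sumTo-cong n f≈0) (sumTo-const-0 n)
    where
    sumTo-const-0 : ∀ n → sumTo n (λ _ → 0#) ≈ 0#
    sumTo-const-0 zero    = refl
    sumTo-const-0 (suc n) = trans (+-identityʳ _) (sumTo-const-0 n)

  sumTo-suc : ∀ n (f : ℕ → Carrier) → sumTo (suc n) f ≈ f 0 + sumTo n (λ i → f (suc i))
  sumTo-suc zero    f = refl
  sumTo-suc (suc n) f = trans (+-cong (sumTo-suc n f) refl) (+-assoc _ _ _)

  sumTo-comm : ∀ m n (f : ℕ → ℕ → Carrier) →
    sumTo m (λ i → sumTo n (f i)) ≈ sumTo n (λ j → sumTo m (λ i → f i j))
  sumTo-comm zero    n f = refl
  sumTo-comm (suc m) n f = trans (+-cong (sumTo-comm m n f) refl) (sym (sumTo-+ n _ _))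

  sumTo-extend : ∀ {m n} (f : ℕ → Carrier) → m ≤ n → (∀ i → m < i → f i ≈ 0#) →
    sumTo m f ≈ sumTo n f
  sumTo-extend {m} f m≤n f>m≈0 = go (≤⇒≤′ m≤n)
    where
    go : ∀ {n} → m ≤′ n → sumTo m f ≈ sumTo n f
    go ≤′-refl      = refl
    go (≤′-step m≤′n) =
      trans (sym (+-identityʳ _)) (+-cong (go m≤′n) (sym (f>m≈0 _ (s≤s (≤′⇒≤ m≤′n)))))

  fromℕ≡×1# : ∀ n → fromℕ n ≡ n × 1#
  fromℕ≡×1# zero    = ≡.refl
  fromℕ≡×1# (suc n) = cong (1# +_) (fromℕ≡×1# n)

  fromℕ-+ : ∀ m n → fromℕ (m ℕ.+ n) ≈ fromℕ m + fromℕ n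
  fromℕ-+ m n = begin
    fromℕ (m ℕ.+ n)       ≡⟨ fromℕ≡×1# (m ℕ.+ n) ⟩
    (m ℕ.+ n) × 1#        ≈⟨ ×-homo-+ 1# m n ⟩
    m × 1# + n × 1#       ≡⟨ cong₂ _+_ (fromℕ≡×1# m) (fromℕ≡×1# n) ⟨
    fromℕ m + fromℕ n     ∎

  fromℕ-* : ∀ m n → fromℕ (m ℕ.* n) ≈ fromℕ m * fromℕ n
  fromℕ-* m n = begin
    fromℕ (m ℕ.* n)       ≡⟨ fromℕ≡×1# (m ℕ.* n) ⟩
    (m ℕ.* n) × 1#        ≈⟨ ×1-homo-* m n ⟩
    (m × 1#) * (n × 1#)   ≡⟨ cong₂ _*_ (fromℕ≡×1# m) (fromℕ≡×1# n) ⟨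
    fromℕ m * fromℕ n     ∎

  fromℕ-suc-* : ∀ k x → x + fromℕ k * x ≈ fromℕ (suc k) * x
  fromℕ-suc-* k x = sym (trans (distribʳ x 1# (fromℕ k)) (+-cong (*-identityˡ x) refl))

  infix 4 _≋_
  _≋_ : Series → Series → Set ℓ
  a ≋ b = ∀ n → a n ≈ b n

  ∂ : Series → Series
  ∂ a n = a (suc n)

  infixl 6 _⊕_
  _⊕_ : Series → Series → Series
  (a ⊕ b) n = a n + b n

  infixr 7 _·_
  _·_ : Carrier → Series → Series
  (s · a) n = s * a n

  ⋆-congˡ : ∀ {a b b'} → b ≋ b' → a ⋆ b ≋ a ⋆ b'
  ⋆-congˡ b≋b' n = sumTo-cong n (λ i _ → *-congˡ (*-congˡ (b≋b' (n ∸ i))))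

  ⋆-congʳ : ∀ {a a' b} → a ≋ a' → a ⋆ b ≋ a' ⋆ b
  ⋆-congʳ a≋a' n = sumTo-cong n (λ i _ → *-congˡ (*-congʳ (a≋a' i)))

  -- Pascal's rule splits the coefficient of a_{i+1} into two convolution sums.
  ⋆-leibniz : ∀ a b → ∂ (a ⋆ b) ≋ ∂ a ⋆ b ⊕ a ⋆ ∂ b
  ⋆-leibniz a b n = begin
    (a ⋆ b) (suc n)                    ≈⟨ sumTo-suc n _ ⟩
    h 0 + sumTo n (λ i → fromℕ (suc n C suc i) * (a (suc i) * b (n ∸ i)))
                                       ≈⟨ +-congˡ (sumTo-cong n (λ i _ → pascal i)) ⟩
    h 0 + sumTo n (λ i → u i + h (suc i))
                                       ≈⟨ +-congˡ (sumTo-+ n u (λ i → h (suc i))) ⟩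
    h 0 + (sumTo n u + sumTo n (λ i → h (suc i)))
                                       ≈⟨ +-CS.x∙yz≈y∙xz _ _ _ ⟩
    sumTo n u + (h 0 + sumTo n (λ i → h (suc i)))
                                       ≈⟨ +-congˡ (sym (sumTo-suc n h)) ⟩
    sumTo n u + sumTo (suc n) h        ≈⟨ +-congˡ (sym (sumTo-extend h (n≤1+n n) h>n≈0)) ⟩
    sumTo n u + sumTo n h              ≈⟨ +-congˡ (sumTo-cong n (λ m m≤n → *-congˡ (*-congˡ
                                            (reflexive (cong b (+-∸-assoc 1 m≤n)))))) ⟩
    (∂ a ⋆ b) n + (a ⋆ ∂ b) n          ∎
    where
    u h : ℕ → Carrier
    u i = fromℕ (n C i) * (a (suc i) * b (n ∸ i))
    h m = fromℕ (n C m) * (a m * b (suc n ∸ m))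
    pascal : ∀ i → fromℕ (suc n C suc i) * (a (suc i) * b (n ∸ i)) ≈ u i + h (suc i)
    pascal i = trans
      (*-congʳ (trans (sym (reflexive (cong fromℕ (nCk+nC[k+1]≡[n+1]C[k+1] n i))))
                      (fromℕ-+ (n C i) (n C suc i))))
      (distribʳ _ _ _)
    h>n≈0 : ∀ i → n < i → h i ≈ 0#
    h>n≈0 i n<i = trans (*-congʳ (reflexive (cong fromℕ (k>n⇒nCk≡0 n<i)))) (zeroˡ _)

  ⋆-comm : ∀ a b → a ⋆ b ≋ b ⋆ a
  ⋆-comm a b zero    = *-congˡ (*-comm _ _)
  ⋆-comm a b (suc n) = begin
    (a ⋆ b) (suc n)               ≈⟨ ⋆-leibniz a b n ⟩
    (∂ a ⋆ b) n + (a ⋆ ∂ b) n     ≈⟨ +-cong (⋆-comm (∂ a) b n) (⋆-comm a (∂ b) n) ⟩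
    (b ⋆ ∂ a) n + (∂ b ⋆ a) n     ≈⟨ +-comm _ _ ⟩
    (∂ b ⋆ a) n + (b ⋆ ∂ a) n     ≈⟨ ⋆-leibniz b a n ⟨
    (b ⋆ a) (suc n)               ∎

  ⋆-distribˡ-⊕ : ∀ a b b' → a ⋆ (b ⊕ b') ≋ a ⋆ b ⊕ a ⋆ b'
  ⋆-distribˡ-⊕ a b b' n =
    trans (sumTo-cong n (λ i _ → trans (*-congˡ (distribˡ _ _ _)) (distribˡ _ _ _))) (sumTo-+ n _ _)

  ⋆-distribʳ-⊕ : ∀ a a' b → (a ⊕ a') ⋆ b ≋ a ⋆ b ⊕ a' ⋆ b
  ⋆-distribʳ-⊕ a a' b n =
    trans (sumTo-cong n (λ i _ → trans (*-congˡ (distribʳ _ _ _)) (distribˡ _ _ _))) (sumTo-+ n _ _)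

  ⋆-·-commʳ : ∀ a s b → a ⋆ (s · b) ≋ s · (a ⋆ b)
  ⋆-·-commʳ a s b n = trans
    (sumTo-cong n (λ i _ → trans (*-congˡ (*-CS.x∙yz≈y∙xz _ s _)) (*-CS.x∙yz≈y∙xz _ s _)))
    (sym (*-distribˡ-sumTo n s _))

  ⋆-zeroʳ : ∀ a b → (∀ n → b n ≈ 0#) → ∀ n → (a ⋆ b) n ≈ 0#
  ⋆-zeroʳ a b b≈0 n = sumTo-zero n _ (λ i _ →
    trans (*-congˡ (trans (*-congˡ (b≈0 (n ∸ i))) (zeroʳ _))) (zeroʳ _))

  ⋆-assoc : ∀ a b e → a ⋆ (b ⋆ e) ≋ (a ⋆ b) ⋆ e
  ⋆-assoc a b e zero = *-congˡ (begin
    a 0 * (1C0 * (b 0 * e 0))      ≈⟨ *-CS.x∙yz≈y∙xz _ _ _ ⟩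
    1C0 * (a 0 * (b 0 * e 0))      ≈⟨ *-congˡ (*-assoc _ _ _) ⟨
    1C0 * ((a 0 * b 0) * e 0)      ≈⟨ *-assoc _ _ _ ⟨
    (1C0 * (a 0 * b 0)) * e 0      ∎)
    where 1C0 = fromℕ (1 C 0)
  ⋆-assoc a b e (suc n) = begin
    (a ⋆ (b ⋆ e)) (suc n)
      ≈⟨ ⋆-leibniz a (b ⋆ e) n ⟩
    (∂ a ⋆ (b ⋆ e)) n + (a ⋆ ∂ (b ⋆ e)) n
      ≈⟨ +-congˡ (trans (⋆-congˡ (⋆-leibniz b e) n) (⋆-distribˡ-⊕ a (∂ b ⋆ e) (b ⋆ ∂ e) n)) ⟩
    (∂ a ⋆ (b ⋆ e)) n + ((a ⋆ (∂ b ⋆ e)) n + (a ⋆ (b ⋆ ∂ e)) n)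
      ≈⟨ +-cong (⋆-assoc (∂ a) b e n) (+-cong (⋆-assoc a (∂ b) e n) (⋆-assoc a b (∂ e) n)) ⟩
    ((∂ a ⋆ b) ⋆ e) n + (((a ⋆ ∂ b) ⋆ e) n + ((a ⋆ b) ⋆ ∂ e) n)
      ≈⟨ +-assoc _ _ _ ⟨
    ((∂ a ⋆ b) ⋆ e) n + ((a ⋆ ∂ b) ⋆ e) n + ((a ⋆ b) ⋆ ∂ e) n
      ≈⟨ +-congʳ (sym (trans (⋆-congʳ {b = e} (⋆-leibniz a b) n) (⋆-distribʳ-⊕ (∂ a ⋆ b) (a ⋆ ∂ b) e n))) ⟩
    (∂ (a ⋆ b) ⋆ e) n + ((a ⋆ b) ⋆ ∂ e) n
      ≈⟨ ⋆-leibniz (a ⋆ b) e n ⟨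
    ((a ⋆ b) ⋆ e) (suc n) ∎

  pow-∂ : ∀ F k → ∂ (pow F (suc k)) ≋ fromℕ (suc k) · (pow F k ⋆ ∂ F)
  pow-∂ F zero n = begin
    (F ⋆ pow F 0) (suc n)                         ≈⟨ ⋆-leibniz F (pow F 0) n ⟩
    (∂ F ⋆ pow F 0) n + (F ⋆ ∂ (pow F 0)) n       ≈⟨ +-cong (⋆-comm (∂ F) (pow F 0) n)
                                                      (⋆-zeroʳ F (∂ (pow F 0)) (λ _ → refl) n) ⟩
    (pow F 0 ⋆ ∂ F) n + 0#                        ≈⟨ +-congˡ (zeroˡ _) ⟨
    (pow F 0 ⋆ ∂ F) n + 0# * (pow F 0 ⋆ ∂ F) n    ≈⟨ fromℕ-suc-* 0 _ ⟩
    fromℕ 1 * (pow F 0 ⋆ ∂ F) n                   ∎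
  pow-∂ F (suc k) n = begin
    (F ⋆ F^k+1) (suc n)                           ≈⟨ ⋆-leibniz F F^k+1 n ⟩
    (∂ F ⋆ F^k+1) n + (F ⋆ ∂ F^k+1) n             ≈⟨ +-cong (⋆-comm (∂ F) F^k+1 n) (⋆-congˡ (pow-∂ F k) n) ⟩
    (F^k+1 ⋆ ∂ F) n + (F ⋆ (k+1 · (pow F k ⋆ ∂ F))) n
                                                  ≈⟨ +-congˡ (⋆-·-commʳ F k+1 (pow F k ⋆ ∂ F) n) ⟩
    (F^k+1 ⋆ ∂ F) n + k+1 * (F ⋆ (pow F k ⋆ ∂ F)) n
                                                  ≈⟨ +-congˡ (*-congˡ (⋆-assoc F (pow F k) (∂ F) n)) ⟩
    (F^k+1 ⋆ ∂ F) n + k+1 * (F^k+1 ⋆ ∂ F) n       ≈⟨ fromℕ-suc-* (suc k) _ ⟩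
    fromℕ (suc (suc k)) * (F^k+1 ⋆ ∂ F) n         ∎
    where
    F^k+1 = pow F (suc k)
    k+1   = fromℕ (suc k)

  pow-vanishes : ∀ F → F 0 ≈ 0# → ∀ k m → m < k → pow F k m ≈ 0#
  pow-vanishes F F0≈0 (suc k) m (s≤s m≤k) = sumTo-zero m _ term≈0
    where
    term≈0 : ∀ i → i ≤ m → fromℕ (m C i) * (F i * pow F k (m ∸ i)) ≈ 0#
    term≈0 zero    _ = trans (*-congˡ (trans (*-congʳ F0≈0) (zeroˡ _))) (zeroʳ _)
    term≈0 (suc i) (s≤s {n = m-1} _) = trans (*-congˡ (trans (*-congˡ
      (pow-vanishes F F0≈0 k (m-1 ∸ i) (≤-trans (s≤s (m∸n≤m m-1 i)) m≤k))) (zeroʳ _))) (zeroʳ _)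

  inv-suc : ∀ (inv : ℕ → Carrier) → (∀ k → fromℕ (k !) * inv k ≈ 1#) →
    ∀ k → inv (suc k) * fromℕ (suc k) ≈ inv k
  inv-suc inv inv-correct k = begin
    v * p                       ≈⟨ *-identityʳ _ ⟨
    (v * p) * 1#                ≈⟨ *-congˡ (inv-correct k) ⟨
    (v * p) * (fromℕ (k !) * u) ≈⟨ *-assoc _ _ _ ⟨
    ((v * p) * fromℕ (k !)) * u ≈⟨ *-congʳ (*-assoc _ _ _) ⟩
    (v * (p * fromℕ (k !))) * u ≈⟨ *-congʳ (*-congˡ (fromℕ-* (suc k) (k !))) ⟨
    (v * fromℕ (suc k !)) * u   ≈⟨ *-congʳ (trans (*-comm _ _) (inv-correct (suc k))) ⟩
    1# * u                      ≈⟨ *-identityˡ u ⟩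
    u                           ∎
    where
    u = inv k
    v = inv (suc k)
    p = fromℕ (suc k)

  expS-pad : ∀ inv F → F 0 ≈ 0# → ∀ {m n} → m ≤ n →
    expS inv F m ≈ sumTo n (λ k → inv k * pow F k m)
  expS-pad inv F F0≈0 {m} m≤n = sumTo-extend _ m≤n
    (λ k m<k → trans (*-congˡ (pow-vanishes F F0≈0 k m m<k)) (zeroʳ _))

  expS-∂ : ∀ inv → (∀ k → fromℕ (k !) * inv k ≈ 1#) →
    ∀ F → F 0 ≈ 0# → ∂ (expS inv F) ≋ expS inv F ⋆ ∂ F
  expS-∂ inv inv-correct F F0≈0 n = trans ∂-expS (sym expS-⋆-∂)
    where
    E = expS inv F
    ∂-expS : E (suc n) ≈ sumTo n (λ k → inv k * (pow F k ⋆ ∂ F) n)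
    ∂-expS = begin
      E (suc n)                 ≈⟨ sumTo-suc n _ ⟩
      inv 0 * 0# + sumTo n (λ k → inv (suc k) * pow F (suc k) (suc n))
                                ≈⟨ trans (+-congʳ (zeroʳ _)) (+-identityˡ _) ⟩
      sumTo n (λ k → inv (suc k) * pow F (suc k) (suc n))
                                ≈⟨ sumTo-cong n (λ k _ → trans (*-congˡ (pow-∂ F k n))
                                     (trans (sym (*-assoc _ _ _)) (*-congʳ (inv-suc inv inv-correct k)))) ⟩
      sumTo n (λ k → inv k * (pow F k ⋆ ∂ F) n) ∎
    expS-⋆-∂ : (E ⋆ ∂ F) n ≈ sumTo n (λ k → inv k * (pow F k ⋆ ∂ F) n)
    expS-⋆-∂ = begin
      sumTo n (λ m → fromℕ (n C m) * (E m * ∂ F (n ∸ m)))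
          ≈⟨ sumTo-cong n (λ m m≤n → *-congˡ (*-congʳ (expS-pad inv F F0≈0 m≤n))) ⟩
      sumTo n (λ m → fromℕ (n C m) * (sumTo n (λ k → inv k * pow F k m) * ∂ F (n ∸ m)))
          ≈⟨ sumTo-cong n (λ m _ → trans (*-congˡ (*-distribʳ-sumTo n _ _)) (*-distribˡ-sumTo n _ _)) ⟩
      sumTo n (λ m → sumTo n (λ k → fromℕ (n C m) * ((inv k * pow F k m) * ∂ F (n ∸ m))))
          ≈⟨ sumTo-comm n n _ ⟩
      sumTo n (λ k → sumTo n (λ m → fromℕ (n C m) * ((inv k * pow F k m) * ∂ F (n ∸ m))))
          ≈⟨ sumTo-cong n (λ k _ → trans (sumTo-cong n (λ m _ → pull-inv _ _ _ _)) (sym (*-distribˡ-sumTo n _ _))) ⟩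
      sumTo n (λ k → inv k * (pow F k ⋆ ∂ F) n) ∎
      where
      pull-inv : ∀ c u p d → c * ((u * p) * d) ≈ u * (c * (p * d))
      pull-inv c u p d = trans (*-congˡ (*-assoc u p d)) (*-CS.x∙yz≈y∙xz c u _)

theorem2 : ∀ {c ℓ} (R : CommutativeRing c ℓ) →
    let open CommutativeRing R
        open Degenerate R
    in (inv : ℕ → Carrier) →
       (∀ k → fromℕ (k !) * inv k ≈ 1#) →
       (λ' : Carrier) (n : ℕ) →
       Bel inv λ' (suc n)
         ≈ sumTo n (λ m → fromℕ (n C m) * (Bel inv λ' m * fallingλ λ' 1# (suc (n ∸ m))))
theorem2 R inv inv-correct λ' n =
  trans (expS-∂ inv inv-correct (xeλm1 λ' 1#) refl n) (⋆-congˡ {b' = λ k → fallingλ λ' 1# (suc k)} (λ k → *-identityˡ _) n)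
  where
  open CommutativeRing R
  open Degenerate R
  open SeriesAlgebra R
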